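{- Let $G$ be a connected graph with vertex set $\{1,\dots,n\}$, $n\ge 2$, let $\Phi=(F_1,\dots,F_n)$ be an $n$-tuple of pairwise disjoint graphs with $|V(F_i)|\ge 2$ for all $i$, and let $G[\Phi]$ be the generalized lexicographic product. Then (i) $\gamma(G[\Phi])=\gamma_r(G[\Phi])=\gamma^{oc}(G[\Phi])$, and (ii) $\gamma_t(G)=\gamma_t(G[\Phi])=\gamma_{tr}(G[\Phi])=\gamma_t^{oc}(G[\Phi])$.
   Context: All graphs are finite, simple and undirected. The generalized lexicographic product $G[\Phi]$ is the graph with vertex set $\bigcup_{i=1}^n V(F_i)$ in which each $F_i$ is an induced subgraph, and for $x\in V(F_i)$, $y\in V(F_j)$ with $i\neq j$, $xy$ is an edge iff $ij\in E(G)$. For a graph $H$ and $S\subseteq V(H)$: $S$ is dominating if every vertex outside $S$ has a neighbor in $S$; total dominating if every vertex of $H$ has a neighbor in $S$; a dominating set $S$ is restrained if every vertex outside $S$ has a neighbor outside $S$, and outer-connected if the subgraph induced by $V(H)\setminus S$ is connected. $\gamma,\gamma_t,\gamma_r,\gamma_{tr},\gamma^{oc},\gamma_t^{oc}$ denote the minimum cardinalities of, respectively, dominating, total dominating, restrained dominating, total restrained dominating (total and restrained), outer-connected dominating, and total outer-connected dominating (total and outer-connected) sets. -}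

module Defs where

open import Data.Unit using (⊤)
open import Data.Bool using (Bool; true; false)
open import Data.Nat using (ℕ; _≤_)
open import Data.Fin using (Fin; _≟_)
open import Data.Product using (Σ; ∃; _×_; _,_)
open import Data.Sum using (_⊎_)
open import Data.List using (List; length)
open import Data.List.Membership.Propositional using (_∈_; _∉_)
open import Data.List.Relation.Unary.Unique.Propositional using (Unique)
open import Relation.Nullary using (yes; no)
open import Relation.Binary.PropositionalEquality using (_≡_; refl)

-- A finite simple graph on the vertex set Fin n (= {1,…,n} up to relabelling),
-- given by a Boolean (hence decidable) symmetric irreflexive adjacency relation.
record Graph (n : ℕ) : Set where
  field
    adj   : Fin n → Fin n → Bool
    sym   : ∀ u v → adj u v ≡ adj v u
    irrefl : ∀ v → adj v v ≡ false
open Graph public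

module _ {V : Set} (A : V → V → Bool) where

  Edge : V → V → Set
  Edge u v = A u v ≡ true

  -- walks whose vertices (except possibly the start) all satisfy P
  data Walk (P : V → Set) : V → V → Set where
    here : ∀ {u} → Walk P u u
    step : ∀ {u v w} → Edge u v → P v → Walk P v w → Walk P u w

  InducedConnected : (V → Set) → Set
  InducedConnected P = ∀ u w → P u → P w → Walk P u w

  Dominating : List V → Set
  Dominating S = ∀ v → v ∈ S ⊎ (∃ λ u → u ∈ S × Edge v u)

  TotalDominating : List V → Set
  TotalDominating S = ∀ v → ∃ λ u → u ∈ S × Edge v u

  RestrainedCond : List V → Set
  RestrainedCond S = ∀ v → v ∉ S → ∃ λ u → u ∉ S × Edge v u

  OuterConnectedCond : List V → Set
  OuterConnectedCond S = InducedConnected (λ v → v ∉ S)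

  RestrainedDominating : List V → Set
  RestrainedDominating S = Dominating S × RestrainedCond S

  TotalRestrainedDominating : List V → Set
  TotalRestrainedDominating S = TotalDominating S × RestrainedCond S

  OuterConnectedDominating : List V → Set
  OuterConnectedDominating S = Dominating S × OuterConnectedCond S

  TotalOuterConnectedDominating : List V → Set
  TotalOuterConnectedDominating S = TotalDominating S × OuterConnectedCond S

-- k is the minimum cardinality of a vertex set (duplicate-free list) with property P
IsMinCard : {V : Set} → (List V → Set) → ℕ → Set
IsMinCard {V} P k =
  (∃ λ (S : List V) → Unique S × P S × length S ≡ k)
  × (∀ (S : List V) → Unique S → P S → k ≤ length S)

Connected : ∀ {n} → Graph n → Set
Connected G = ∀ u w → Walk (adj G) (λ _ → ⊤) u w

-- Vertex set of G[Φ]: disjoint union of the V(F_i), vertices tagged by i.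
LexVertex : (n : ℕ) → (m : Fin n → ℕ) → Set
LexVertex n m = Σ (Fin n) (λ i → Fin (m i))

lexAdj : ∀ {n} {m : Fin n → ℕ} → Graph n → ((i : Fin n) → Graph (m i))
       → LexVertex n m → LexVertex n m → Bool
lexAdj G F (i , x) (j , y) with i ≟ j
... | yes refl = adj (F i) x y
... | no _     = adj G i j

-- Outside its own block, a vertex (i , x) of G[Φ] sees exactly the blocks of the
-- G-neighbours of i. Hence a total dominating set of G lifts to one of G[Φ] by taking one
-- vertex per block, and a total dominating set S of G[Φ] projects to one of G of at most the
-- same size: a block met by S but dominated from no other block contains two vertices of S,
-- and one of them can be sent to a neighbouring block. A dominating set of G[Φ] that
-- contains a whole block can likewise be rearranged by keeping one vertex of that block and
-- replacing the rest by one vertex of a neighbouring block. So every minimum (total)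
-- dominating set may be taken to leave a vertex free in every block; since G is connected
-- and has no isolated vertex, the free vertices then make the complement connected and
-- free of isolated vertices, i.e. restrained and outer-connected come at no extra cost.

module Submission where

open import Defs hiding (sym)
open import Data.Empty using (⊥-elim)
open import Data.Unit using (⊤)
open import Data.Bool using (Bool; true) renaming (_≟_ to _≟ᵇ_)
open import Data.Nat using (ℕ; zero; suc; _≤_; _<_; s≤s)
open import Data.Nat.Properties using (≮⇒≥; ≤-antisym; ≤-trans; ≤-reflexive)
open import Data.Nat.Induction using (<-rec)
open import Data.Fin using (Fin; zero; suc; toℕ; fromℕ<; _≟_)
open import Data.Fin.Properties using (any?; all?; ¬∀⟶∃¬; toℕ<n; toℕ-fromℕ<)
open import Data.Product using (∃; _×_; _,_; proj₁; proj₂)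
open import Data.Product.Properties using (≡-dec)
open import Data.Sum using (_⊎_; inj₁; inj₂) renaming (map to map-⊎)
open import Data.List using (List; []; _∷_; length; map; deduplicate; allFin)
open import Data.List.Properties using (length-map; length-deduplicate)
open import Data.List.Membership.Propositional using (_∈_; _∉_; find; lose)
open import Data.List.Membership.Propositional.Properties
  using (∈-map⁺; ∈-map⁻; ∈-deduplicate⁺; ∈-deduplicate⁻; ∈-allFin)
open import Data.List.Membership.DecPropositional using () renaming (_∈?_ to member?)
open import Data.List.Relation.Unary.Unique.Propositional using (Unique)
open import Data.List.Relation.Unary.Unique.Propositional.Properties using (map⁺; allFin⁺)
open import Data.List.Relation.Unary.Unique.DecPropositional.Properties using (deduplicate-!)
open import Data.List.Relation.Unary.Unique.DecPropositional using (unique?)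
open import Data.List.Relation.Unary.Any using (Any) renaming (any? to anyᴸ?)
open import Relation.Nullary using (Dec; yes; no; ¬_; contradiction)
open import Relation.Nullary.Decidable using (decidable-stable; _×-dec_; _⊎-dec_; ¬?)
open import Relation.Unary using (Decidable)
open import Relation.Binary.Definitions using (DecidableEquality)
open import Relation.Binary.PropositionalEquality using (_≡_; _≢_; refl; sym; trans; cong; subst)

LeastWitness : (ℕ → Set) → Set
LeastWitness Q = ∃ λ k → Q k × (∀ {j} → Q j → k ≤ j)

least-witness : {Q : ℕ → Set} → Decidable Q → ∀ {L} → Q L → LeastWitness Q
least-witness {Q} Q? {L} = <-rec (λ L → Q L → LeastWitness Q) below L
  where
  below : ∀ L → (∀ {j} → j < L → Q j → LeastWitness Q) → Q L → LeastWitness Q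
  below L rec qL with any? {n = L} (λ j → Q? (toℕ j))
  ... | yes (j , qj) = rec (toℕ<n j) qj
  ... | no none      = L , qL , λ {j} qj → ≮⇒≥ λ j<L →
                         none (fromℕ< j<L , subst Q (sym (toℕ-fromℕ< j<L)) qj)

Searchable : Set → Set₁
Searchable V = ∀ {P : V → Set} → Decidable P → Dec (∃ P)

module FiniteSearch {V : Set} (search : Searchable V) (_≟ᵥ_ : DecidableEquality V) where

  all?ᵥ : {P : V → Set} → Decidable P → Dec (∀ v → P v)
  all?ᵥ P? with search (λ v → ¬? (P? v))
  ... | yes (v , ¬p) = no λ all → ¬p (all v)
  ... | no none = yes λ v → decidable-stable (P? v) λ ¬p → none (v , ¬p)

  ofLength? : ∀ ℓ {R : List V → Set} → Decidable R → Dec (∃ λ S → length S ≡ ℓ × R S)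
  ofLength? zero R? with R? []
  ... | yes r = yes ([] , refl , r)
  ... | no ¬r = no λ { ([] , _ , r) → ¬r r ; (_ ∷ _ , () , _) }
  ofLength? (suc ℓ) R? with search (λ v → ofLength? ℓ (λ T → R? (v ∷ T)))
  ... | yes (v , T , refl , r) = yes (v ∷ T , refl , r)
  ... | no none = no λ { ([] , () , _) ; (v ∷ T , refl , r) → none (v , T , refl , r) }

  minCard-exists : {P : List V → Set} → Decidable P → (∃ λ S → Unique S × P S) → ∃ (IsMinCard P)
  minCard-exists {P} P? (S₀ , u₀ , p₀) with least-witness card? (S₀ , u₀ , p₀ , refl)
    where
    card? : Decidable (λ k → ∃ λ S → Unique S × P S × length S ≡ k)
    card? k with ofLength? k (λ S → unique? _≟ᵥ_ S ×-dec P? S)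
    ... | yes (S , e , u , p) = yes (S , u , p , e)
    ... | no none = no λ (S , u , p , e) → none (S , e , u , p)
  ... | k , witness , minimal = k , witness , λ S u p → minimal (S , u , p , refl)

  dominating? : (A : V → V → Bool) → Decidable (Dominating A)
  dominating? A S = all?ᵥ λ v → member? _≟ᵥ_ v S ⊎-dec search λ u → member? _≟ᵥ_ u S ×-dec (A v u ≟ᵇ true)

  totalDominating? : (A : V → V → Bool) → Decidable (TotalDominating A)
  totalDominating? A S = all?ᵥ λ v → search λ u → member? _≟ᵥ_ u S ×-dec (A v u ≟ᵇ true)

length-deduplicate-map : {U V : Set} (_≟_ : DecidableEquality V) (f : U → V) (xs : List U)
                       → length (deduplicate _≟_ (map f xs)) ≤ length xs
length-deduplicate-map _≟_ f xs = ≤-trans (length-deduplicate _≟_ (map f xs)) (≤-reflexive (length-map f xs))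

ShrinksTo : {U V : Set} → (List U → Set) → (List V → Set) → Set
ShrinksTo P Q = ∀ S → Unique S → P S → ∃ λ T → Unique T × Q T × length T ≤ length S

shrinksTo-weaken : {V : Set} {P Q : List V → Set} → (∀ {S} → P S → Q S) → ShrinksTo P Q
shrinksTo-weaken P⇒Q S u p = S , u , P⇒Q p , ≤-reflexive refl

shrinksTo-trans : {U V W : Set} {P : List U → Set} {Q : List V → Set} {R : List W → Set}
                → ShrinksTo P Q → ShrinksTo Q R → ShrinksTo P R
shrinksTo-trans P→Q Q→R S u p with P→Q S u p
... | T , uT , q , T≤S with Q→R T uT q
... | W , uW , r , W≤T = W , uW , r , ≤-trans W≤T T≤S

isMinCard-transfer : {U V : Set} {P : List U → Set} {Q : List V → Set} {k : ℕ}
                   → ShrinksTo P Q → ShrinksTo Q P → IsMinCard P k → IsMinCard Q k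
isMinCard-transfer {Q = Q} P→Q Q→P ((S , u , p , refl) , minimal) with P→Q S u p
... | T , uT , q , T≤S = (T , uT , q , ≤-antisym T≤S (lowerBound T uT q)) , lowerBound
  where
  lowerBound : ∀ T → Unique T → Q T → length S ≤ length T
  lowerBound T uT q with Q→P T uT q
  ... | W , uW , p , W≤T = ≤-trans (minimal W uW p) W≤T

another : ∀ {k} → 2 ≤ k → Fin k → Fin k
another (s≤s (s≤s _)) zero    = suc zero
another (s≤s (s≤s _)) (suc _) = zero

another-≢ : ∀ {k} (2≤k : 2 ≤ k) (x : Fin k) → another 2≤k x ≢ x
another-≢ (s≤s (s≤s _)) zero    ()
another-≢ (s≤s (s≤s _)) (suc _) ()

anElement : ∀ {k} → 2 ≤ k → Fin k
anElement (s≤s _) = zero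

NoIsolatedVertex : ∀ {n} → Graph n → Set
NoIsolatedVertex G = ∀ i → ∃ λ j → Edge (adj G) i j

module _ {n : ℕ} (G : Graph n) where

  edge-irrefl : ∀ {i j} → Edge (adj G) i j → i ≢ j
  edge-irrefl {i} e refl = contradiction (trans (sym e) (irrefl G i)) λ ()

  edge-sym : ∀ {i j} → Edge (adj G) i j → Edge (adj G) j i
  edge-sym {i} {j} e = trans (Graph.sym G j i) e

walk-firstEdge : {V : Set} {A : V → V → Bool} {P : V → Set} {u w : V}
               → Walk A P u w → u ≢ w → ∃ λ v → Edge A u v
walk-firstEdge here         u≢w = ⊥-elim (u≢w refl)
walk-firstEdge (step e _ _) _   = _ , e

connected⇒noIsolated : ∀ {n} → 2 ≤ n → (G : Graph n) → Connected G → NoIsolatedVertex G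
connected⇒noIsolated 2≤n G conn i =
  walk-firstEdge (conn i (another 2≤n i)) λ i≡ → another-≢ 2≤n i (sym i≡)

module LexProduct {n : ℕ} (G : Graph n) {m : Fin n → ℕ} (F : (i : Fin n) → Graph (m i)) where

  V : Set
  V = LexVertex n m

  H : V → V → Bool
  H = lexAdj G F

  lexAdj-≢ : ∀ {i j} (x : Fin (m i)) (y : Fin (m j)) → i ≢ j → H (i , x) (j , y) ≡ adj G i j
  lexAdj-≢ {i} {j} x y i≢j with i ≟ j
  ... | yes refl = ⊥-elim (i≢j refl)
  ... | no _     = refl

  lexAdj-≡ : ∀ {i} (x y : Fin (m i)) → H (i , x) (i , y) ≡ adj (F i) x y
  lexAdj-≡ {i} x y with i ≟ i
  ... | yes refl = refl
  ... | no i≢i   = ⊥-elim (i≢i refl)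

  lexAdj-edge : ∀ {i j} {x : Fin (m i)} {y : Fin (m j)} → Edge (adj G) i j → Edge H (i , x) (j , y)
  lexAdj-edge {x = x} {y} e = trans (lexAdj-≢ x y (edge-irrefl G e)) e

  _≟ᵥ_ : DecidableEquality V
  _≟ᵥ_ = ≡-dec _≟_ _≟_

  searchᵥ : Searchable V
  searchᵥ P? with any? (λ i → any? (λ x → P? (i , x)))
  ... | yes (i , x , p) = yes ((i , x) , p)
  ... | no none         = no λ ((i , x) , p) → none (i , x , p)

  MissesEveryBlock : List V → Set
  MissesEveryBlock S = ∀ i → ∃ λ x → (i , x) ∉ S

  module _ (noIsolated : NoIsolatedVertex G) where

    private
      nb : Fin n → Fin n
      nb i = proj₁ (noIsolated i)

      nb-edge : ∀ i → Edge (adj G) i (nb i)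
      nb-edge i = proj₂ (noIsolated i)

    module _ {S : List V} (miss : MissesEveryBlock S) where

      private
        free : ∀ i → Fin (m i)
        free i = proj₁ (miss i)

        free∉ : ∀ i → (i , free i) ∉ S
        free∉ i = proj₂ (miss i)

      missesEveryBlock⇒restrained : RestrainedCond H S
      missesEveryBlock⇒restrained (i , x) _ = (nb i , free (nb i)) , free∉ (nb i) , lexAdj-edge (nb-edge i)

      withinBlockWalk : ∀ i a b → (i , b) ∉ S → Walk H (_∉ S) (i , a) (i , b)
      withinBlockWalk i a b b∉S =
        step (lexAdj-edge e) (free∉ (nb i)) (step (lexAdj-edge (edge-sym G e)) b∉S here)
        where
        e : Edge (adj G) i (nb i)
        e = nb-edge i

      liftWalk : ∀ {i j} → Walk (adj G) (λ _ → ⊤) i j → ∀ a b → (j , b) ∉ S → Walk H (_∉ S) (i , a) (j , b)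
      liftWalk here            a b b∉S = withinBlockWalk _ a b b∉S
      liftWalk (step e _ walk) a b b∉S = step (lexAdj-edge e) (free∉ _) (liftWalk walk _ b b∉S)

      missesEveryBlock⇒outerConnected : Connected G → OuterConnectedCond H S
      missesEveryBlock⇒outerConnected conn (i , a) (j , b) _ b∉S = liftWalk (conn i j) a b b∉S

    module Domination (2≤m : ∀ i → 2 ≤ m i) where

      base : ∀ i → Fin (m i)
      base i = anElement (2≤m i)

      liftBlocks : List (Fin n) → List V
      liftBlocks = map λ i → i , base i

      liftBlocks-base : ∀ {D i x} → (i , x) ∈ liftBlocks D → x ≡ base i
      liftBlocks-base {D} p with ∈-map⁻ (λ i → i , base i) {xs = D} p
      ... | _ , _ , refl = refl

      liftBlocks-missesEveryBlock : ∀ D → MissesEveryBlock (liftBlocks D)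
      liftBlocks-missesEveryBlock D i =
        another (2≤m i) (base i) , λ p → another-≢ (2≤m i) (base i) (liftBlocks-base {D} p)

      liftBlocks-totalDominating : ∀ {D} → TotalDominating (adj G) D → TotalDominating H (liftBlocks D)
      liftBlocks-totalDominating td (i , _) with td i
      ... | j , j∈D , e = (j , base j) , ∈-map⁺ _ j∈D , lexAdj-edge e

      totalDominating-lift : ShrinksTo (TotalDominating (adj G)) (λ S → TotalDominating H S × MissesEveryBlock S)
      totalDominating-lift D u td =
        liftBlocks D , map⁺ (cong proj₁) u ,
        (liftBlocks-totalDominating td , liftBlocks-missesEveryBlock D) , ≤-reflexive (length-map _ D)

      module Representative (S : List V) where

        occupied? : ∀ i → Dec (∃ λ x → (i , x) ∈ S)
        occupied? i = any? λ x → member? _≟ᵥ_ (i , x) S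

        rep : ∀ i → Fin (m i)
        rep i with occupied? i
        ... | yes (x , _) = x
        ... | no _        = base i

        rep-∈ : ∀ {i x} → (i , x) ∈ S → (i , rep i) ∈ S
        rep-∈ {i} {x} p with occupied? i
        ... | yes (_ , q) = q
        ... | no none     = ⊥-elim (none (x , p))

      module Projection (S : List V) (td : TotalDominating H S) where
        open Representative S

        ExternallyDominated : Fin n → Set
        ExternallyDominated i = Any (λ s → Edge (adj G) i (proj₁ s)) S

        externallyDominated? : ∀ i → Dec (ExternallyDominated i)
        externallyDominated? i = anyᴸ? (λ s → adj G i (proj₁ s) ≟ᵇ true) S

        project : V → Fin n
        project (i , x) with externallyDominated? i | x ≟ rep i
        ... | yes _ | _     = i
        ... | no _  | yes _ = i
        ... | no _  | no _  = nb i

        project-external : ∀ {i} x → ExternallyDominated i → project (i , x) ≡ i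
        project-external {i} x ext with externallyDominated? i | x ≟ rep i
        ... | yes _   | _ = refl
        ... | no ¬ext | _ = ⊥-elim (¬ext ext)

        project-rep : ∀ i → project (i , rep i) ≡ i
        project-rep i with externallyDominated? i | rep i ≟ rep i
        ... | yes _ | _        = refl
        ... | no _  | yes _    = refl
        ... | no _  | no x≢x   = ⊥-elim (x≢x refl)

        project-other : ∀ {i x} → ¬ ExternallyDominated i → x ≢ rep i → project (i , x) ≡ nb i
        project-other {i} {x} ¬ext x≢rep with externallyDominated? i | x ≟ rep i
        ... | yes ext | _        = ⊥-elim (¬ext ext)
        ... | no _    | yes x≡rep = ⊥-elim (x≢rep x≡rep)
        ... | no _    | no _     = refl

        D : List (Fin n)
        D = deduplicate _≟_ (map project S)

        project-∈ : ∀ {s} → s ∈ S → project s ∈ D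
        project-∈ p = ∈-deduplicate⁺ _≟_ (∈-map⁺ project p)

        block-∈ : ∀ {i x} → (i , x) ∈ S → i ∈ D
        block-∈ {i} {x} p with externallyDominated? i
        ... | yes ext = subst (_∈ D) (project-external x ext) (project-∈ p)
        ... | no _    = subst (_∈ D) (project-rep i) (project-∈ (rep-∈ p))

        sameBlock : ∀ {i x u} → ¬ ExternallyDominated i → u ∈ S → Edge H (i , x) u → ∃ λ y → u ≡ (i , y)
        sameBlock {i} {x} {j , y} ¬ext u∈S e with j ≟ i
        ... | yes refl = y , refl
        ... | no j≢i   = ⊥-elim (¬ext (lose u∈S (trans (sym (lexAdj-≢ x y λ i≡j → j≢i (sym i≡j))) e)))

        neighbour-∈ : ∀ {i y} → ¬ ExternallyDominated i → (i , y) ∈ S → nb i ∈ D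
        neighbour-∈ {i} {y} ¬ext y∈S with td (i , y)
        ... | u , u∈S , e with sameBlock ¬ext u∈S e
        ... | y′ , refl with y ≟ rep i
        ...   | no y≢rep  = subst (_∈ D) (project-other ¬ext y≢rep) (project-∈ y∈S)
        ...   | yes refl = subst (_∈ D) (project-other ¬ext y′≢rep) (project-∈ u∈S)
          where
          y′≢rep : y′ ≢ rep i
          y′≢rep refl = contradiction (trans (sym e) (trans (lexAdj-≡ y′ y′) (irrefl (F i) y′))) λ ()

        D-totalDominating : TotalDominating (adj G) D
        D-totalDominating i with externallyDominated? i
        ... | yes ext with find ext
        ...   | (j , y) , s∈S , e = j , block-∈ s∈S , e
        D-totalDominating i | no ¬ext with td (i , base i)
        ... | u , u∈S , e with sameBlock ¬ext u∈S e
        ...   | y , refl = nb i , neighbour-∈ ¬ext u∈S , nb-edge i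

        D-length : length D ≤ length S
        D-length = length-deduplicate-map _≟_ project S

      totalDominating-project : ShrinksTo (TotalDominating H) (TotalDominating (adj G))
      totalDominating-project S _ td = D , deduplicate-! _≟_ (map project S) , D-totalDominating , D-length
        where open Projection S td

      module Collapse (S : List V) where
        open Representative S

        Full : Fin n → Set
        Full i = ∀ x → (i , x) ∈ S

        full? : ∀ i → Dec (Full i)
        full? i = all? λ x → member? _≟ᵥ_ (i , x) S

        collapse : V → V
        collapse (i , x) with full? i | x ≟ rep i
        ... | yes _ | yes _ = i , rep i
        ... | yes _ | no _  = nb i , rep (nb i)
        ... | no _  | _     = i , x

        S′ : List V
        S′ = deduplicate _≟ᵥ_ (map collapse S)

        collapse-∈ : ∀ {s} → s ∈ S → collapse s ∈ S′
        collapse-∈ p = ∈-deduplicate⁺ _≟ᵥ_ (∈-map⁺ collapse p)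

        collapse-notFull : ∀ {i} x → ¬ Full i → collapse (i , x) ≡ (i , x)
        collapse-notFull {i} x ¬full with full? i | x ≟ rep i
        ... | yes full | _ = ⊥-elim (¬full full)
        ... | no _     | _ = refl

        collapse-rep : ∀ {i} → Full i → collapse (i , rep i) ≡ (i , rep i)
        collapse-rep {i} full with full? i | rep i ≟ rep i
        ... | yes _ | yes _  = refl
        ... | yes _ | no x≢x = ⊥-elim (x≢x refl)
        ... | no ¬full | _   = ⊥-elim (¬full full)

        collapse-other : ∀ {i x} → Full i → x ≢ rep i → collapse (i , x) ≡ (nb i , rep (nb i))
        collapse-other {i} {x} full x≢rep with full? i | x ≟ rep i
        ... | yes _    | yes x≡rep = ⊥-elim (x≢rep x≡rep)
        ... | yes _    | no _      = refl
        ... | no ¬full | _         = ⊥-elim (¬full full)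

        Kept : V → Set
        Kept (i , x) = x ≡ rep i ⊎ (¬ Full i × (i , x) ∈ S)

        collapse-kept : ∀ {s} → s ∈ S → Kept (collapse s)
        collapse-kept {i , x} s∈S with full? i | x ≟ rep i
        ... | yes _    | yes _ = inj₁ refl
        ... | yes _    | no _  = inj₁ refl
        ... | no ¬full | _     = inj₂ (¬full , s∈S)

        spare : ∀ i → ∃ λ w → w ≢ rep i × (¬ Full i → (i , w) ∉ S)
        spare i with full? i
        ... | yes full = another (2≤m i) (rep i) , another-≢ (2≤m i) (rep i) , λ ¬full → ⊥-elim (¬full full)
        ... | no ¬full with ¬∀⟶∃¬ (m i) _ (λ x → member? _≟ᵥ_ (i , x) S) ¬full
        ...   | x , x∉S with x ≟ rep i
        ...     | no x≢rep = x , x≢rep , λ _ → x∉S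
        ...     | yes refl = another (2≤m i) x , another-≢ (2≤m i) x , λ _ w∈S → x∉S (rep-∈ w∈S)

        S′-missesEveryBlock : MissesEveryBlock S′
        S′-missesEveryBlock i with spare i
        ... | w , w≢rep , w∉S = w , λ w∈S′ → notKept (kept w∈S′)
          where
          kept : (i , w) ∈ S′ → Kept (i , w)
          kept p with ∈-map⁻ collapse (∈-deduplicate⁻ _≟ᵥ_ (map collapse S) p)
          ... | s , s∈S , eq = subst Kept (sym eq) (collapse-kept s∈S)
          notKept : ¬ Kept (i , w)
          notKept (inj₁ w≡rep)        = w≢rep w≡rep
          notKept (inj₂ (¬full , w∈S)) = w∉S ¬full w∈S

        DominatedBy : List V → V → Set
        DominatedBy T v = v ∈ T ⊎ ∃ λ u → u ∈ T × Edge H v u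

        fullBlock-dominates : ∀ {k} → Full k → ∀ y → DominatedBy S′ (k , y)
        fullBlock-dominates {k} full y with y ≟ rep k
        ... | yes refl  = inj₁ (subst (_∈ S′) (collapse-rep full) (collapse-∈ (full (rep k))))
        ... | no y≢rep  = inj₂ (_ , subst (_∈ S′) (collapse-other full y≢rep) (collapse-∈ (full y)) , lexAdj-edge (nb-edge k))

        blocks-adjacent : ∀ {i k} {y : Fin (m i)} {x : Fin (m k)} → i ≢ k
                        → (i , y) ≡ (k , x) ⊎ Edge H (i , y) (k , x) → Edge (adj G) i k
        blocks-adjacent i≢k (inj₁ refl) = ⊥-elim (i≢k refl)
        blocks-adjacent {y = y} {x} i≢k (inj₂ e) = trans (sym (lexAdj-≢ y x i≢k)) e

        collapse-dominates : ∀ {v u} → u ∈ S → v ≡ u ⊎ Edge H v u → DominatedBy S′ v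
        collapse-dominates {i , y} {k , x} u∈S v~u with full? k
        ... | no ¬full = map-⊎ (λ v≡u → subst (_∈ S′) (trans (collapse-notFull x ¬full) (sym v≡u)) (collapse-∈ u∈S))
                                      (λ e → (k , x) , subst (_∈ S′) (collapse-notFull x ¬full) (collapse-∈ u∈S) , e) v~u
        ... | yes full = nearFullBlock v~u (i ≟ k)
          where
          nearFullBlock : (i , y) ≡ (k , x) ⊎ Edge H (i , y) (k , x) → Dec (i ≡ k) → DominatedBy S′ (i , y)
          nearFullBlock _   (yes refl) = fullBlock-dominates full y
          nearFullBlock v~u (no i≢k)   =
            inj₂ ((k , rep k) , subst (_∈ S′) (collapse-rep full) (collapse-∈ (full (rep k))) ,
                  lexAdj-edge (blocks-adjacent i≢k v~u))

        S′-dominating : Dominating H S → Dominating H S′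
        S′-dominating dom v with dom v
        ... | inj₁ v∈S            = collapse-dominates v∈S (inj₁ refl)
        ... | inj₂ (u , u∈S , e) = collapse-dominates u∈S (inj₂ e)

        S′-length : length S′ ≤ length S
        S′-length = length-deduplicate-map _≟ᵥ_ collapse S

      dominating-collapse : ShrinksTo (Dominating H) (λ S → Dominating H S × MissesEveryBlock S)
      dominating-collapse S _ dom =
        S′ , deduplicate-! _≟ᵥ_ (map collapse S) , (S′-dominating dom , S′-missesEveryBlock) , S′-length
        where open Collapse S

      allFin-totalDominating : TotalDominating (adj G) (allFin n)
      allFin-totalDominating i = nb i , ∈-allFin (nb i) , nb-edge i

      totalDominatingᴳ-minCard : ∃ (IsMinCard (TotalDominating (adj G)))
      totalDominatingᴳ-minCard =
        FiniteSearch.minCard-exists any? _≟_ (FiniteSearch.totalDominating? any? _≟_ (adj G))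
          (allFin n , allFin⁺ n , allFin-totalDominating)

      dominating-minCard : ∃ (IsMinCard (Dominating H))
      dominating-minCard =
        FiniteSearch.minCard-exists searchᵥ _≟ᵥ_ (FiniteSearch.dominating? searchᵥ _≟ᵥ_ H)
          (liftBlocks (allFin n) , map⁺ (cong proj₁) (allFin⁺ n) ,
           λ v → inj₂ (liftBlocks-totalDominating allFin-totalDominating v))

      dominationNumbers-agree : Connected G
        → ∃ λ k → IsMinCard (Dominating H) k
                × IsMinCard (RestrainedDominating H) k
                × IsMinCard (OuterConnectedDominating H) k
      dominationNumbers-agree conn with dominating-minCard
      ... | γ , γ-min = γ , γ-min , isMinCard-transfer restrained (shrinksTo-weaken proj₁) γ-min
                                  , isMinCard-transfer outerConnected (shrinksTo-weaken proj₁) γ-min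
        where
        restrained : ShrinksTo (Dominating H) (RestrainedDominating H)
        restrained = shrinksTo-trans dominating-collapse
          (shrinksTo-weaken λ (dom , miss) → dom , missesEveryBlock⇒restrained miss)
        outerConnected : ShrinksTo (Dominating H) (OuterConnectedDominating H)
        outerConnected = shrinksTo-trans dominating-collapse
          (shrinksTo-weaken λ (dom , miss) → dom , missesEveryBlock⇒outerConnected miss conn)

      totalDominationNumbers-agree : Connected G
        → ∃ λ k → IsMinCard (TotalDominating (adj G)) k
                × IsMinCard (TotalDominating H) k
                × IsMinCard (TotalRestrainedDominating H) k
                × IsMinCard (TotalOuterConnectedDominating H) k
      totalDominationNumbers-agree conn with totalDominatingᴳ-minCard
      ... | γₜ , γₜ-min = γₜ , γₜ-min , isMinCard-transfer (liftTo proj₁) totalDominating-project γₜ-min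
                                      , isMinCard-transfer (liftTo restrained) projectFrom γₜ-min
                                      , isMinCard-transfer (liftTo outerConnected) projectFrom γₜ-min
        where
        liftTo : {P : List V → Set} → (∀ {S} → TotalDominating H S × MissesEveryBlock S → P S)
               → ShrinksTo (TotalDominating (adj G)) P
        liftTo strengthen = shrinksTo-trans totalDominating-lift (shrinksTo-weaken strengthen)
        projectFrom : {R : List V → Set} → ShrinksTo (λ S → TotalDominating H S × R S) (TotalDominating (adj G))
        projectFrom = shrinksTo-trans (shrinksTo-weaken proj₁) totalDominating-project
        restrained : ∀ {S} → TotalDominating H S × MissesEveryBlock S → TotalRestrainedDominating H S
        restrained (td , miss) = td , missesEveryBlock⇒restrained miss
        outerConnected : ∀ {S} → TotalDominating H S × MissesEveryBlock S → TotalOuterConnectedDominating H S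
        outerConnected (td , miss) = td , missesEveryBlock⇒outerConnected miss conn

theorem2p7 : (n : ℕ) → 2 ≤ n → (G : Graph n) → Connected G
    → (m : Fin n → ℕ) → ((i : Fin n) → 2 ≤ m i) → (F : (i : Fin n) → Graph (m i))
    → (∃ λ k → IsMinCard (Dominating (lexAdj G F)) k
                × IsMinCard (RestrainedDominating (lexAdj G F)) k
                × IsMinCard (OuterConnectedDominating (lexAdj G F)) k)
      × (∃ λ k → IsMinCard (TotalDominating (adj G)) k
                × IsMinCard (TotalDominating (lexAdj G F)) k
                × IsMinCard (TotalRestrainedDominating (lexAdj G F)) k
                × IsMinCard (TotalOuterConnectedDominating (lexAdj G F)) k)
theorem2p7 n 2≤n G conn m 2≤m F = dominationNumbers-agree conn , totalDominationNumbers-agree conn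
  where open LexProduct.Domination G F (connected⇒noIsolated 2≤n G conn) 2≤m
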